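{- Let $G$ be a signed digraph. If each strong component of $G$ is robustly separating, then $G$ is separating.
   Context: A signed digraph $G=(V,E)$ has finite vertex set $V$ and arcs $E\subseteq V\times V\times\{ -1,1\}$. A strong component is an induced subgraph $G[I]$ that is strongly connected (in the underlying digraph) and maximal with this property. A spanning subgraph of a signed digraph $H=(W,E_H)$ is $(W,E')$ with $E'\subseteq E_H$. A BN on $W$ is $f:\{0,1\}^W\to\{0,1\}^W$; $G(f)$ has a positive (negative) arc from $j$ to $i$ iff for some $x$ with $x_j=0$, $f_i(x+e_j)-f_i(x)$ is positive (negative) ($e_j$ = configuration equal to $1$ only at $j$, $+$ mod 2); $F(H)=\{f:G(f)=H\}$. $\Gamma(f)$ is the digraph on $\{0,1\}^W$ with arcs $x\to x+e_i$ whenever $f_i(x)\neq x_i$; unions take the union of arc sets. For a digraph on $\{0,1\}^W$: an attractor is an inclusion-minimal nonempty set with no outgoing arc; a subspace is $\{x:x_i=c(i)\ \forall i\in I\}$; $[X]$ the smallest subspace containing $X$; the digraph is separating if $[A]\cap[B]=\emptyset$ for all distinct attractors $A,B$. $H$ is separating if $\Gamma(f)$ is separating for all $f\in F(H)$, and robustly separating if for every nonempty set $\mathcal F$ of BNs on $W$ with $G(f)$ a spanning subgraph of $H$ for all $f\in\mathcal F$, $\bigcup_{f\in\mathcal F}\Gamma(f)$ is separating. -}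

module Defs where

open import Data.Nat using (ℕ)
open import Data.Fin using (Fin)
open import Data.Fin.Subset using (Subset; _∈_; _⊆_)
open import Data.Bool using (Bool; true; false; not)
open import Data.Vec using (Vec; lookup; _[_]%=_)
open import Data.Product using (Σ; ∃; _×_; _,_)
open import Data.Empty using (⊥)
open import Relation.Nullary using (¬_)
open import Relation.Binary.PropositionalEquality using (_≡_; _≢_)
open import Relation.Binary.Construct.Closure.ReflexiveTransitive using (Star)
open import Level using (Level) renaming (suc to lsuc; zero to lzero)

data Sign : Set where
  pos neg : Sign

-- G j i s : there is an arc from j to i with sign s
SDigraph : ℕ → Set₁
SDigraph n = Fin n → Fin n → Sign → Set

UArc : ∀ {n} → SDigraph n → Fin n → Fin n → Set
UArc G j i = ∃ λ s → G j i s

InducedArc : ∀ {n} → SDigraph n → Subset n → Fin n → Fin n → Set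
InducedArc G I u v = u ∈ I × v ∈ I × UArc G u v

StronglyConnected : ∀ {n} → SDigraph n → Subset n → Set
StronglyConnected G I = ∀ u v → u ∈ I → v ∈ I → Star (InducedArc G I) u v

StrongComponent : ∀ {n} → SDigraph n → Subset n → Set
StrongComponent {n} G I =
  StronglyConnected G I × (∀ (J : Subset n) → I ⊆ J → StronglyConnected G J → J ⊆ I)

-- the induced subgraph G[I], with I enumerated by an injection ι : Fin k → Fin n
Induced : ∀ {n k} → SDigraph n → (Fin k → Fin n) → SDigraph k
Induced G ι a b s = G (ι a) (ι b) s

Config : ℕ → Set
Config k = Vec Bool k

BN : ℕ → Set
BN k = Config k → Config k

flip : ∀ {k} → Config k → Fin k → Config k
flip x j = x [ j ]%= not

GArc : ∀ {k} → BN k → Fin k → Fin k → Sign → Set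
GArc f j i pos = ∃ λ x → lookup x j ≡ false × lookup (f x) i ≡ false × lookup (f (flip x j)) i ≡ true
GArc f j i neg = ∃ λ x → lookup x j ≡ false × lookup (f x) i ≡ true × lookup (f (flip x j)) i ≡ false

InF : ∀ {k} → SDigraph k → BN k → Set
InF H f = ∀ j i s → (GArc f j i s → H j i s) × (H j i s → GArc f j i s)

SpanningSub : ∀ {k} → BN k → SDigraph k → Set
SpanningSub f H = ∀ j i s → GArc f j i s → H j i s

CDigraph : ℕ → Set₁
CDigraph k = Config k → Config k → Set

Γ : ∀ {k} → BN k → CDigraph k
Γ f x y = ∃ λ i → lookup (f x) i ≢ lookup x i × y ≡ flip x i

Γ⋃ : ∀ {k} → (BN k → Set) → CDigraph k
Γ⋃ 𝓕 x y = ∃ λ f → 𝓕 f × Γ f x y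

CSet : ℕ → Set₁
CSet k = Config k → Set

_⊆c_ : ∀ {k} → CSet k → CSet k → Set
A ⊆c B = ∀ x → A x → B x

NonEmpty : ∀ {k} → CSet k → Set
NonEmpty A = ∃ λ x → A x

Trap : ∀ {k} → CDigraph k → CSet k → Set
Trap D A = ∀ x y → A x → D x y → A y

Attractor : ∀ {k} → CDigraph k → CSet k → Set₁
Attractor D A =
  NonEmpty A × Trap D A ×
  (∀ B → NonEmpty B → Trap D B → B ⊆c A → A ⊆c B)

Subspace : ∀ {k} → Subset k → Config k → CSet k
Subspace I c x = ∀ i → i ∈ I → lookup x i ≡ lookup c i

Span : ∀ {k} → CSet k → CSet k
Span {k} X x = ∀ (I : Subset k) (c : Config k) → X ⊆c Subspace I c → Subspace I c x

SeparatingDG : ∀ {k} → CDigraph k → Set₁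
SeparatingDG {k} D =
  ∀ (A B : CSet k) → Attractor D A → Attractor D B →
    ¬ (A ⊆c B × B ⊆c A) → ∀ x → ¬ (Span A x × Span B x)

Separating : ∀ {k} → SDigraph k → Set₁
Separating {k} H = ∀ (f : BN k) → InF H f → SeparatingDG (Γ f)

RobustlySeparating : ∀ {k} → SDigraph k → Set₁
RobustlySeparating {k} H =
  ∀ (𝓕 : BN k → Set) → (∃ λ f → 𝓕 f) →
    (∀ f → 𝓕 f → SpanningSub f H) → SeparatingDG (Γ⋃ 𝓕)

{-# OPTIONS --safe #-}
-- Fix f with G(f) = G, attractors A, B of Γ(f) and x₀ ∈ [A] ∩ [B]. By well-founded induction
-- over predecessor-closed vertex sets P, every point of A agrees on P with a point of B and
-- vice versa; for P the whole vertex set this forces A = B. Such a P is peeled as the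
-- predecessor-closed set P′ plus a strong component C all of whose in-neighbours lie in
-- P′ ∪ C. Then f on C is determined by the coordinates in P′ ∪ C, and by the induction
-- hypothesis the P′-coordinates can be synchronised, inside an attractor, with those of any
-- z ∈ A. Hence the projections of A and B to C are attractors of the union of the networks
-- w ↦ f(z with C-part w)|C (z ∈ A), whose interaction graphs are spanning subgraphs of G[C].
-- Their spans meet at x₀|C, so robust separation of G[C] makes them equal, and this lifts
-- back to agreement on P′ ∪ C. The argument is classical; it runs in the double-negation
-- monad, which suffices because separation is a negative statement.

module Submission where

open import Defs
open import Data.Bool using (Bool; true; false; not)
open import Data.Bool.Properties using (not-involutive; ¬-not) renaming (_≟_ to _≟ᵇ_)
open import Data.Empty using (⊥-elim)
open import Data.Fin using (Fin; zero; suc; _≟_)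
open import Data.Fin.Subset
  using (Subset; _∈_; _∉_; _⊆_; _⊂_; _∪_; _∩_; ∁; ⊤; ⊥; inside; outside)
open import Data.Fin.Subset.Properties
  using (_∈?_; ∈⊤; ∉⊥; x∈p∪q⁻; x∈p∪q⁺; x∈p∩q⁻; x∈p∩q⁺; x∈∁p⇒x∉p; x∉p⇒x∈∁p; nonempty?)
open import Data.Fin.Subset.Induction using (⊂-wellFounded)
open import Data.Fin.Properties using (suc-injective)
open import Data.List using (List; []; _∷_; allFin)
open import Data.List.Membership.Propositional using () renaming (_∈_ to _∈ˡ_; _∉_ to _∉ˡ_)
open import Data.List.Membership.Propositional.Properties using (∈-allFin)
import Data.List.Relation.Unary.Any as Any
open import Data.Nat using (ℕ; zero; suc)
open import Data.Product using (Σ; ∃; ∄; _×_; _,_; proj₁; proj₂)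
open import Data.Sum using (_⊎_; inj₁; inj₂)
open import Data.Vec using (Vec; []; _∷_; lookup; tabulate; updateAt; _[_]≔_; here; there)
open import Data.Vec.Properties
  using (lookup∘updateAt; lookup∘updateAt′; lookup∘tabulate; tabulate∘lookup; tabulate-cong;
         updateAt-updateAt; updateAt-id; updateAt-cong; updateAt-cong-local; []≔-lookup;
         []=⇒lookup; lookup⇒[]=)
open import Effect.Monad using (RawMonad)
open import Function using (_∘_; _⇔_; mk⇔; Equivalence)
open import Induction.WellFounded using (Acc; acc)
import Level
open import Relation.Binary.Construct.Closure.ReflexiveTransitive using (Star; ε; _◅_; _◅◅_)
open import Relation.Binary.PropositionalEquality
open import Relation.Nullary using (¬_; Dec; yes; no; contradiction)
open import Relation.Nullary.Decidable using (¬¬-excluded-middle)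
open import Relation.Nullary.Negation using (DoubleNegation; ¬¬-Monad)

open RawMonad (¬¬-Monad {Level.zero}) using (pure; _>>=_)
open Equivalence using (to; from)

private
  variable
    n k : ℕ

lookup-extensionality : ∀ {A : Set} (xs ys : Vec A n) → (∀ i → lookup xs i ≡ lookup ys i) → xs ≡ ys
lookup-extensionality xs ys eq = begin
  xs                   ≡⟨ tabulate∘lookup xs ⟨
  tabulate (lookup xs) ≡⟨ tabulate-cong eq ⟩
  tabulate (lookup ys) ≡⟨ tabulate∘lookup ys ⟩
  ys                   ∎
  where open ≡-Reasoning

lookup-flip : ∀ (x : Config n) j → lookup (flip x j) j ≡ not (lookup x j)
lookup-flip x j = lookup∘updateAt j x

lookup-flip′ : ∀ (x : Config n) {i j} → i ≢ j → lookup (flip x j) i ≡ lookup x i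
lookup-flip′ x {i} {j} i≢j = lookup∘updateAt′ i j i≢j x

flip-involutive : ∀ (x : Config n) j → flip (flip x j) j ≡ x
flip-involutive x j = begin
  updateAt (updateAt x j not) j not ≡⟨ updateAt-updateAt j x ⟩
  updateAt x j (not ∘ not)          ≡⟨ updateAt-cong j not-involutive x ⟩
  updateAt x j (λ b → b)            ≡⟨ updateAt-id j x ⟩
  x                                 ∎
  where open ≡-Reasoning

¬¬-subset : (Q : Fin n → Set) → DoubleNegation (∃ λ (S : Subset n) → ∀ i → i ∈ S ⇔ Q i)
¬¬-subset {zero} Q = pure ([] , λ ())
¬¬-subset {suc n} Q = do
  Q₀? ← ¬¬-excluded-middle
  (S , S⇔Q) ← ¬¬-subset (Q ∘ suc)
  pure (cons Q₀? S S⇔Q)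
  where
  tail⇔ : ∀ {s} (S : Subset n) → (∀ i → i ∈ S ⇔ Q (suc i)) → ∀ i → suc i ∈ (s ∷ S) ⇔ Q (suc i)
  tail⇔ S S⇔Q i = mk⇔ (λ { (there m) → to (S⇔Q i) m }) (λ q → there (from (S⇔Q i) q))

  cons : Dec (Q zero) → (S : Subset n) → (∀ i → i ∈ S ⇔ Q (suc i)) →
         ∃ λ (S′ : Subset (suc n)) → ∀ i → i ∈ S′ ⇔ Q i
  cons (yes q) S S⇔Q = inside ∷ S , λ { zero → mk⇔ (λ _ → q) (λ _ → here) ; (suc i) → tail⇔ S S⇔Q i }
  cons (no ¬q) S S⇔Q = outside ∷ S , λ { zero → mk⇔ (λ ()) (⊥-elim ∘ ¬q) ; (suc i) → tail⇔ S S⇔Q i }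

record Enumeration (C : Subset n) : Set where
  field
    size      : ℕ
    ι         : Fin size → Fin n
    injective : ∀ a b → ι a ≡ ι b → a ≡ b
    range     : ∀ v → (v ∈ C → ∃ λ a → ι a ≡ v) × ((∃ λ a → ι a ≡ v) → v ∈ C)

  index : ∀ {i} → i ∈ C → Fin size
  index {i} i∈C = proj₁ (proj₁ (range i) i∈C)

  ι-index : ∀ {i} (i∈C : i ∈ C) → ι (index i∈C) ≡ i
  ι-index {i} i∈C = proj₂ (proj₁ (range i) i∈C)

  ι∈C : ∀ a → ι a ∈ C
  ι∈C a = proj₂ (range (ι a)) (a , refl)

  index-ι : ∀ {a} (ιa∈C : ι a ∈ C) → index ιa∈C ≡ a
  index-ι ιa∈C = injective _ _ (ι-index ιa∈C)

  index-irrelevant : ∀ {i} (p q : i ∈ C) → index p ≡ index q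
  index-irrelevant p q = injective _ _ (trans (ι-index p) (sym (ι-index q)))

enumerate : (C : Subset n) → Enumeration C
enumerate [] = record { size = 0 ; ι = λ () ; injective = λ () ; range = λ () }
enumerate (s ∷ C) = cons s
  where
  open Enumeration (enumerate C)

  cons : ∀ s → Enumeration (s ∷ C)
  cons outside = record
    { size = size ; ι = suc ∘ ι
    ; injective = λ a b eq → injective a b (suc-injective eq)
    ; range = λ { zero → (λ ()) , (λ { (_ , ()) })
                ; (suc v) → (λ { (there v∈C) → let (a , eq) = proj₁ (range v) v∈C in a , cong suc eq })
                          , (λ { (a , eq) → there (proj₂ (range v) (a , suc-injective eq)) }) } }
  cons inside = record { size = suc size ; ι = ι′ ; injective = injective′ ; range = range′ }
    where
    ι′ : Fin (suc size) → Fin (suc _)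
    ι′ zero    = zero
    ι′ (suc a) = suc (ι a)

    injective′ : ∀ a b → ι′ a ≡ ι′ b → a ≡ b
    injective′ zero    zero    _  = refl
    injective′ (suc a) (suc b) eq = cong suc (injective a b (suc-injective eq))

    range′ : ∀ v → (v ∈ (inside ∷ C) → ∃ λ a → ι′ a ≡ v) × ((∃ λ a → ι′ a ≡ v) → v ∈ (inside ∷ C))
    range′ zero    = (λ _ → zero , refl) , (λ _ → here)
    range′ (suc v) = (λ { (there v∈C) → let (a , eq) = proj₁ (range v) v∈C in suc a , cong suc eq })
                   , (λ { (suc a , eq) → there (proj₂ (range v) (a , suc-injective eq)) })

module _ {D : CDigraph k} where

  Trap-Star : ∀ {X : CSet k} → Trap D X → ∀ {x y} → Star D x y → X x → X y
  Trap-Star trap ε         Xx = Xx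
  Trap-Star trap (e ◅ x↝y) Xx = Trap-Star trap x↝y (trap _ _ Xx e)

  Attractor-connected : ∀ {X : CSet k} → Attractor D X → ∀ {x y} → X x → X y → Star D x y
  Attractor-connected {X} (_ , trap , minimal) {x} Xx =
    minimal (Star D x) (x , ε) (λ _ _ x↝y e → x↝y ◅◅ (e ◅ ε)) (λ _ x↝y → Trap-Star trap x↝y Xx) _

AgreeOn : Subset n → Config n → Config n → Set
AgreeOn P x y = ∀ i → i ∈ P → lookup x i ≡ lookup y i

AgreeOff : Subset n → Config n → Config n → Set
AgreeOff P x y = ∀ i → i ∉ P → lookup x i ≡ lookup y i

AgreeOn-flip : ∀ {P} {x y : Config n} i → AgreeOn P x y → AgreeOn P (flip x i) (flip y i)
AgreeOn-flip {x = x} {y} i x≈y j j∈P with j ≟ i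
... | yes refl = trans (lookup-flip x j) (trans (cong not (x≈y j j∈P)) (sym (lookup-flip y j)))
... | no j≢i   = trans (lookup-flip′ x j≢i) (trans (x≈y j j∈P) (sym (lookup-flip′ y j≢i)))

AgreeOn-flipʳ : ∀ {P} {x y : Config n} {i} → i ∉ P → AgreeOn P x y → AgreeOn P x (flip y i)
AgreeOn-flipʳ {y = y} i∉P x≈y j j∈P = trans (x≈y j j∈P) (sym (lookup-flip′ y λ { refl → i∉P j∈P }))

AgreeOn-∪ : ∀ {P Q} {x y : Config n} → AgreeOn P x y → AgreeOn Q x y → AgreeOn (P ∪ Q) x y
AgreeOn-∪ {P = P} {Q} x≈y-on-P x≈y-on-Q i i∈P∪Q with x∈p∪q⁻ P Q i∈P∪Q
... | inj₁ i∈P = x≈y-on-P i i∈P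
... | inj₂ i∈Q = x≈y-on-Q i i∈Q

_⊆[_]_ : CSet n → Subset n → CSet n → Set
X ⊆[ P ] Y = ∀ x → X x → ∃ λ y → Y y × AgreeOn P x y

⊆[]-refl : ∀ {X : CSet n} P → X ⊆[ P ] X
⊆[]-refl P x Xx = x , Xx , λ _ _ → refl

⊆[]-antimono : ∀ {X Y : CSet n} {P Q} → P ⊆ Q → X ⊆[ Q ] Y → X ⊆[ P ] Y
⊆[]-antimono P⊆Q X⊆Y x Xx = let (y , Yy , x≈y) = X⊆Y x Xx in y , Yy , λ i i∈P → x≈y i (P⊆Q i∈P)

⊆[⊤]⇒⊆c : ∀ {X Y : CSet n} → X ⊆[ ⊤ ] Y → X ⊆c Y
⊆[⊤]⇒⊆c {Y = Y} X⊆Y x Xx =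
  let (y , Yy , x≈y) = X⊆Y x Xx in subst Y (sym (lookup-extensionality x y λ i → x≈y i ∈⊤)) Yy

PredecessorClosed : SDigraph n → Subset n → Set
PredecessorClosed G P = ∀ j i → UArc G j i → i ∈ P → j ∈ P

module Locality {G : SDigraph n} {f : BN n} (f∈F : InF G f) where

  f-flip-invariant₀ : ∀ {i j} → ¬ UArc G j i → ∀ x → lookup x j ≡ false →
                      lookup (f x) i ≡ lookup (f (flip x j)) i
  f-flip-invariant₀ {i} {j} ¬j→i x xj with lookup (f x) i in e₁ | lookup (f (flip x j)) i in e₂
  ... | false | false = refl
  ... | true  | true  = refl
  ... | false | true  = contradiction (pos , proj₁ (f∈F j i pos) (x , xj , e₁ , e₂)) ¬j→i
  ... | true  | false = contradiction (neg , proj₁ (f∈F j i neg) (x , xj , e₁ , e₂)) ¬j→i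

  f-flip-invariant : ∀ {i j} → ¬ UArc G j i → ∀ x → lookup (f x) i ≡ lookup (f (flip x j)) i
  f-flip-invariant {i} {j} ¬j→i x with lookup x j in xj
  ... | false = f-flip-invariant₀ ¬j→i x xj
  ... | true  = sym (begin
    lookup (f (flip x j)) i            ≡⟨ f-flip-invariant₀ ¬j→i (flip x j) (trans (lookup-flip x j) (cong not xj)) ⟩
    lookup (f (flip (flip x j) j)) i   ≡⟨ cong (λ y → lookup (f y) i) (flip-involutive x j) ⟩
    lookup (f x) i                     ∎)
    where open ≡-Reasoning

  f-update-invariant : ∀ {i j} {b} x → (UArc G j i → lookup x j ≡ b) →
                       lookup (f x) i ≡ lookup (f (x [ j ]≔ b)) i
  f-update-invariant {i} {j} {b} x arc⇒xj≡b with lookup x j ≟ᵇ b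
  ... | yes refl = cong (λ y → lookup (f y) i) (sym ([]≔-lookup x j))
  ... | no xj≢b  = trans (f-flip-invariant (xj≢b ∘ arc⇒xj≡b) x)
                         (cong (λ y → lookup (f y) i) (updateAt-cong-local j x (sym (¬-not (xj≢b ∘ sym)))))

  f-local-off : ∀ {i} (L : List (Fin n)) {x y : Config n} →
                (∀ j → j ∉ˡ L → lookup x j ≡ lookup y j) →
                (∀ j → UArc G j i → lookup x j ≡ lookup y j) →
                lookup (f x) i ≡ lookup (f y) i
  f-local-off {i} [] {x} {y} x≈y _ =
    cong (λ z → lookup (f z) i) (lookup-extensionality x y (λ j → x≈y j λ ()))
  f-local-off {i} (j ∷ L) {x} {y} x≈y x≈y-on-inputs =
    trans (f-update-invariant x (x≈y-on-inputs j))
          (f-local-off L (λ l l∉L → x′≈y l (λ l≢j → x≈y l λ { (Any.here l≡j) → l≢j l≡j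
                                                             ; (Any.there l∈L) → l∉L l∈L }))
                         (λ l l→i → x′≈y l (λ _ → x≈y-on-inputs l l→i)))
    where
    x′≈y : ∀ l → (l ≢ j → lookup x l ≡ lookup y l) → lookup (x [ j ]≔ lookup y j) l ≡ lookup y l
    x′≈y l x≈y-off-j with l ≟ j
    ... | yes refl = lookup∘updateAt l x
    ... | no l≢j   = trans (lookup∘updateAt′ l j l≢j x) (x≈y-off-j l≢j)

  f-local : ∀ {i} {x y : Config n} → (∀ j → UArc G j i → lookup x j ≡ lookup y j) →
            lookup (f x) i ≡ lookup (f y) i
  f-local = f-local-off (allFin n) (λ j j∉ → contradiction (∈-allFin j) j∉)

  -- Steps outside Q are dropped; a step at i ∈ Q can be replayed from x, because
  -- f i reads only coordinates in Q, on which x and s agree.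
  shadow : ∀ {Q} → PredecessorClosed G Q → ∀ {s t} → Star (Γ f) s t → ∀ {x} → AgreeOn Q x s →
           ∃ λ y → Star (Γ f) x y × AgreeOn Q y t × AgreeOff Q y x
  shadow closed ε x≈s = _ , ε , x≈s , λ _ _ → refl
  shadow {Q} closed {s} ((i , fs≢s , refl) ◅ s′↝t) {x} x≈s with i ∈? Q
  ... | no i∉Q = shadow closed s′↝t (AgreeOn-flipʳ {x = x} {s} i∉Q x≈s)
  ... | yes i∈Q =
    let (y , x′↝y , y≈t , y≈x′) = shadow closed s′↝t (AgreeOn-flip {x = x} {s} i x≈s)
    in y , step ◅ x′↝y , y≈t , λ j j∉Q → trans (y≈x′ j j∉Q) (lookup-flip′ x λ { refl → j∉Q i∈Q })
    where
    step : Γ f x (flip x i)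
    step = i , (λ fx≡x → fs≢s (trans (sym (f-local λ j j→i → x≈s j (closed j i j→i i∈Q)))
                                     (trans fx≡x (x≈s i i∈Q))))
             , refl

  Attractor-recombine : ∀ {Q} {X : CSet n} → PredecessorClosed G Q → Attractor (Γ f) X →
                        ∀ {x x′} → X x → X x′ → ∃ λ y → X y × AgreeOn Q y x′ × AgreeOff Q y x
  Attractor-recombine closed attX@(_ , trap , _) Xx Xx′ =
    let (y , x↝y , y≈x′ , y≈x) = shadow closed (Attractor-connected attX Xx Xx′) (λ _ _ → refl)
    in y , Trap-Star trap x↝y Xx , y≈x′ , y≈x

module Components (G : SDigraph n) where

  Reach : Fin n → Fin n → Set
  Reach = Star (UArc G)

  Reach-closed : ∀ {P} → PredecessorClosed G P → ∀ {u w} → Reach u w → w ∈ P → u ∈ P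
  Reach-closed closed ε         w∈P = w∈P
  Reach-closed closed (e ◅ u↝w) w∈P = closed _ _ e (Reach-closed closed u↝w w∈P)

  Induced⇒Reach : ∀ {J u w} → Star (InducedArc G J) u w → Reach u w
  Induced⇒Reach ε                 = ε
  Induced⇒Reach ((_ , _ , e) ◅ r) = e ◅ Induced⇒Reach r

  Sink : Subset n → Fin n → Set
  Sink P u = ∄ λ w → w ∈ P × Reach u w × ¬ Reach w u

  ¬¬-sink-below : ∀ {P} D → Acc _⊂_ D → ∀ {v} → v ∈ P → (∀ w → w ∈ D ⇔ (w ∈ P × Reach v w)) →
                  DoubleNegation (∃ λ u → u ∈ P × Sink P u)
  ¬¬-sink-below {P} D (acc below) {v} v∈P D⇔ = do
    yes (w , w∈P , v↝w , ¬w↝v) ← ¬¬-excluded-middle {A = ∃ λ w → w ∈ P × Reach v w × ¬ Reach w v}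
      where no no-escape → pure (v , v∈P , no-escape)
    (D′ , D′⇔) ← ¬¬-subset (λ u → u ∈ P × Reach w u)
    ¬¬-sink-below D′ (below (D′⊂D v↝w ¬w↝v D′⇔)) w∈P D′⇔
    where
    D′⊂D : ∀ {w D′} → Reach v w → ¬ Reach w v → (∀ u → u ∈ D′ ⇔ (u ∈ P × Reach w u)) → D′ ⊂ D
    D′⊂D v↝w ¬w↝v D′⇔ =
      (λ {u} u∈D′ → let (u∈P , w↝u) = to (D′⇔ u) u∈D′ in from (D⇔ u) (u∈P , v↝w ◅◅ w↝u)) ,
      v , from (D⇔ v) (v∈P , ε) , ¬w↝v ∘ proj₂ ∘ to (D′⇔ v)

  ¬¬-sink : ∀ {P v} → v ∈ P → DoubleNegation (∃ λ u → u ∈ P × Sink P u)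
  ¬¬-sink {P} {v} v∈P = do
    (D , D⇔) ← ¬¬-subset (λ w → w ∈ P × Reach v w)
    ¬¬-sink-below D (⊂-wellFounded D) v∈P D⇔

  module Peel {P} (P-closed : PredecessorClosed G P) {v} (v∈P : v ∈ P) (sink : Sink P v)
              {C} (C⇔ : ∀ i → i ∈ C ⇔ (Reach v i × Reach i v)) where

    rest : Subset n
    rest = P ∩ ∁ C

    v∈C : v ∈ C
    v∈C = from (C⇔ v) (ε , ε)

    C⊆P : C ⊆ P
    C⊆P {i} i∈C = Reach-closed P-closed (proj₂ (to (C⇔ i) i∈C)) v∈P

    C∩rest=∅ : ∀ {i} → i ∈ C → i ∉ rest
    C∩rest=∅ {i} i∈C i∈rest = x∈∁p⇒x∉p (proj₂ (x∈p∩q⁻ P (∁ C) i∈rest)) i∈C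

    rest⊆P : rest ⊆ P
    rest⊆P i∈rest = proj₁ (x∈p∩q⁻ P (∁ C) i∈rest)

    rest⊂P : rest ⊂ P
    rest⊂P = rest⊆P , v , v∈P , C∩rest=∅ v∈C

    P-split : ∀ {i} → i ∈ P → i ∈ rest ⊎ i ∈ C
    P-split {i} i∈P with i ∈? C
    ... | yes i∈C = inj₂ i∈C
    ... | no  i∉C = inj₁ (x∈p∩q⁺ (i∈P , x∉p⇒x∈∁p i∉C))

    P⊆rest∪C : P ⊆ rest ∪ C
    P⊆rest∪C = x∈p∪q⁺ ∘ P-split

    inputs-of-C : ∀ j i → UArc G j i → i ∈ C → j ∈ rest ⊎ j ∈ C
    inputs-of-C j i j→i i∈C = P-split (P-closed j i j→i (C⊆P i∈C))

    -- An arc from C into rest would let v reach a vertex of P that cannot reach v back.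
    rest-closed : PredecessorClosed G rest
    rest-closed j i j→i i∈rest with P-split (P-closed j i j→i (rest⊆P i∈rest))
    ... | inj₁ j∈rest = j∈rest
    ... | inj₂ j∈C    =
      contradiction (i , rest⊆P i∈rest , v↝i , λ i↝v → C∩rest=∅ (from (C⇔ i) (v↝i , i↝v)) i∈rest) sink
      where
      v↝i : Reach v i
      v↝i = proj₁ (to (C⇔ j) j∈C) ◅◅ (j→i ◅ ε)

    C-component : StrongComponent G C
    C-component = connected , maximal
      where
      inside-C : ∀ {u w} → Reach v u → Reach u w → Reach w v → Star (InducedArc G C) u w
      inside-C v↝u ε         w↝v = ε
      inside-C v↝u (e ◅ u↝w) w↝v =
        (from (C⇔ _) (v↝u , (e ◅ u↝w) ◅◅ w↝v) , from (C⇔ _) (v↝u ◅◅ (e ◅ ε) , u↝w ◅◅ w↝v) , e)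
        ◅ inside-C (v↝u ◅◅ (e ◅ ε)) u↝w w↝v

      connected : StronglyConnected G C
      connected u w u∈C w∈C =
        let (v↝u , u↝v) = to (C⇔ u) u∈C
            (v↝w , w↝v) = to (C⇔ w) w∈C
        in inside-C v↝u (u↝v ◅◅ v↝w) w↝v

      maximal : ∀ J → C ⊆ J → StronglyConnected G J → J ⊆ C
      maximal J C⊆J J-connected {u} u∈J =
        from (C⇔ u) (Induced⇒Reach (J-connected v u (C⊆J v∈C) u∈J) ,
                     Induced⇒Reach (J-connected u v u∈J (C⊆J v∈C)))

module Restriction {C : Subset n} (E : Enumeration C) where

  open Enumeration E

  restrict : Config n → Config size
  restrict x = tabulate (lookup x ∘ ι)

  lookup-restrict : ∀ x a → lookup (restrict x) a ≡ lookup x (ι a)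
  lookup-restrict x = lookup∘tabulate (lookup x ∘ ι)

  select : Config n → Config size → (i : Fin n) → Dec (i ∈ C) → Bool
  select z w i (yes i∈C) = lookup w (index i∈C)
  select z w i (no  _)   = lookup z i

  patch : Config n → Config size → Config n
  patch z w = tabulate λ i → select z w i (i ∈? C)

  lookup-patch-∈ : ∀ z w {i} (i∈C : i ∈ C) → lookup (patch z w) i ≡ lookup w (index i∈C)
  lookup-patch-∈ z w {i} i∈C rewrite lookup∘tabulate (λ i → select z w i (i ∈? C)) i with i ∈? C
  ... | yes i∈C′ = cong (lookup w) (index-irrelevant i∈C′ i∈C)
  ... | no  i∉C  = contradiction i∈C i∉C

  lookup-patch-∉ : ∀ z w {i} → i ∉ C → lookup (patch z w) i ≡ lookup z i
  lookup-patch-∉ z w {i} i∉C rewrite lookup∘tabulate (λ i → select z w i (i ∈? C)) i with i ∈? C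
  ... | yes i∈C = contradiction i∈C i∉C
  ... | no  _   = refl

  lookup-patch-ι : ∀ z w a → lookup (patch z w) (ι a) ≡ lookup w a
  lookup-patch-ι z w a = trans (lookup-patch-∈ z w (ι∈C a)) (cong (lookup w) (index-ι (ι∈C a)))

  patch-restrict : ∀ z x → AgreeOn C (patch z (restrict x)) x
  patch-restrict z x i i∈C = begin
    lookup (patch z (restrict x)) i ≡⟨ lookup-patch-∈ z (restrict x) i∈C ⟩
    lookup (restrict x) (index i∈C) ≡⟨ lookup-restrict x (index i∈C) ⟩
    lookup x (ι (index i∈C))        ≡⟨ cong (lookup x) (ι-index i∈C) ⟩
    lookup x i                      ∎
    where open ≡-Reasoning

  AgreeOn⇒restrict-≡ : ∀ {x y} → AgreeOn C x y → restrict x ≡ restrict y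
  AgreeOn⇒restrict-≡ {x} {y} x≈y = lookup-extensionality _ _ λ a →
    trans (lookup-restrict x a) (trans (x≈y (ι a) (ι∈C a)) (sym (lookup-restrict y a)))

  restrict-≡⇒AgreeOn : ∀ {x y} → restrict x ≡ restrict y → AgreeOn C x y
  restrict-≡⇒AgreeOn {x} {y} eq i i∈C = begin
    lookup x i                      ≡⟨ patch-restrict x x i i∈C ⟨
    lookup (patch x (restrict x)) i ≡⟨ cong (λ w → lookup (patch x w) i) eq ⟩
    lookup (patch x (restrict y)) i ≡⟨ patch-restrict x y i i∈C ⟩
    lookup y i                      ∎
    where open ≡-Reasoning

  restrict-flip-ι : ∀ x a → restrict (flip x (ι a)) ≡ flip (restrict x) a
  restrict-flip-ι x a = lookup-extensionality _ _ λ b → trans (lookup-restrict (flip x (ι a)) b) (on-ι b)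
    where
    on-ι : ∀ b → lookup (flip x (ι a)) (ι b) ≡ lookup (flip (restrict x) a) b
    on-ι b with b ≟ a
    ... | yes refl = trans (lookup-flip x (ι b))
                           (trans (cong not (sym (lookup-restrict x b))) (sym (lookup-flip (restrict x) b)))
    ... | no  b≢a  = trans (lookup-flip′ x (b≢a ∘ injective b a))
                           (trans (sym (lookup-restrict x b)) (sym (lookup-flip′ (restrict x) b≢a)))

  restrict-flip-∉ : ∀ x {i} → i ∉ C → restrict (flip x i) ≡ restrict x
  restrict-flip-∉ x i∉C = lookup-extensionality _ _ λ a →
    trans (lookup-restrict (flip x _) a)
          (trans (lookup-flip′ x λ { refl → i∉C (ι∈C a) }) (sym (lookup-restrict x a)))

  patch-flip : ∀ z w a → patch z (flip w a) ≡ flip (patch z w) (ι a)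
  patch-flip z w a = lookup-extensionality _ _ pointwise
    where
    on-ι : ∀ b → lookup (patch z (flip w a)) (ι b) ≡ lookup (flip (patch z w) (ι a)) (ι b)
    on-ι b with b ≟ a
    ... | yes refl = begin
      lookup (patch z (flip w b)) (ι b) ≡⟨ lookup-patch-ι z (flip w b) b ⟩
      lookup (flip w b) b               ≡⟨ lookup-flip w b ⟩
      not (lookup w b)                  ≡⟨ cong not (lookup-patch-ι z w b) ⟨
      not (lookup (patch z w) (ι b))    ≡⟨ lookup-flip (patch z w) (ι b) ⟨
      lookup (flip (patch z w) (ι b)) (ι b) ∎
      where open ≡-Reasoning
    ... | no b≢a = begin
      lookup (patch z (flip w a)) (ι b) ≡⟨ lookup-patch-ι z (flip w a) b ⟩
      lookup (flip w a) b               ≡⟨ lookup-flip′ w b≢a ⟩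
      lookup w b                        ≡⟨ lookup-patch-ι z w b ⟨
      lookup (patch z w) (ι b)          ≡⟨ lookup-flip′ (patch z w) (b≢a ∘ injective b a) ⟨
      lookup (flip (patch z w) (ι a)) (ι b) ∎
      where open ≡-Reasoning

    pointwise : ∀ i → lookup (patch z (flip w a)) i ≡ lookup (flip (patch z w) (ι a)) i
    pointwise i with i ∈? C
    ... | yes i∈C = subst (λ j → lookup (patch z (flip w a)) j ≡ lookup (flip (patch z w) (ι a)) j)
                          (ι-index i∈C) (on-ι (index i∈C))
    ... | no  i∉C = begin
      lookup (patch z (flip w a)) i     ≡⟨ lookup-patch-∉ z (flip w a) i∉C ⟩
      lookup z i                        ≡⟨ lookup-patch-∉ z w i∉C ⟨
      lookup (patch z w) i              ≡⟨ lookup-flip′ (patch z w) (λ { refl → i∉C (ι∈C a) }) ⟨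
      lookup (flip (patch z w) (ι a)) i ∎
      where open ≡-Reasoning

  -- Subsets are Boolean vectors, so a subset of the index set patches into the empty one.
  lift : Subset size → Subset n
  lift I = patch ⊥ I

  ι∈lift : ∀ {I a} → a ∈ I → ι a ∈ lift I
  ι∈lift {I} {a} a∈I = lookup⇒[]= (ι a) (lift I) (trans (lookup-patch-ι ⊥ I a) ([]=⇒lookup a∈I))

  ∈lift⇒index∈ : ∀ {I i} → i ∈ lift I → Σ (i ∈ C) λ i∈C → index i∈C ∈ I
  ∈lift⇒index∈ {I} {i} i∈lift with i ∈? C
  ... | yes i∈C = i∈C , lookup⇒[]= (index i∈C) I (trans (sym (lookup-patch-∈ ⊥ I i∈C)) ([]=⇒lookup i∈lift))
  ... | no  i∉C = contradiction (lookup⇒[]= i ⊥ (trans (sym (lookup-patch-∉ ⊥ I i∉C)) ([]=⇒lookup i∈lift))) ∉⊥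

module Separation {G : SDigraph n} {f : BN n} (f∈F : InF G f)
                  {A : CSet n} (attA : Attractor (Γ f) A)
                  {P C : Subset n} (P-closed : PredecessorClosed G P)
                  (C∩P=∅ : ∀ {i} → i ∈ C → i ∉ P)
                  (inputs-of-C : ∀ j i → UArc G j i → i ∈ C → j ∈ P ⊎ j ∈ C)
                  (E : Enumeration C) where

  open Enumeration E
  open Restriction E
  open Locality f∈F

  local : Config n → BN size
  local z w = restrict (f (patch z w))

  lookup-local : ∀ z w b → lookup (local z w) b ≡ lookup (f (patch z w)) (ι b)
  lookup-local z w b = lookup-restrict (f (patch z w)) b

  f-agrees-local : ∀ {x z} → AgreeOn P x z → ∀ a → lookup (f x) (ι a) ≡ lookup (local z (restrict x)) a
  f-agrees-local {x} {z} x≈z a =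
    trans (f-local {x = x} {patch z (restrict x)} x≈patch) (sym (lookup-local z (restrict x) a))
    where
    x≈patch : ∀ j → UArc G j (ι a) → lookup x j ≡ lookup (patch z (restrict x)) j
    x≈patch j j→ιa with inputs-of-C j (ι a) j→ιa (ι∈C a)
    ... | inj₁ j∈P = trans (x≈z j j∈P) (sym (lookup-patch-∉ z _ λ j∈C → C∩P=∅ j∈C j∈P))
    ... | inj₂ j∈C = sym (patch-restrict z x j j∈C)

  lookup-local-flip : ∀ z w a b → lookup (local z (flip w a)) b ≡ lookup (f (flip (patch z w) (ι a))) (ι b)
  lookup-local-flip z w a b =
    trans (lookup-local z (flip w a) b) (cong (λ x → lookup (f x) (ι b)) (patch-flip z w a))

  GArc-local : ∀ z a b s → GArc (local z) a b s → GArc f (ι a) (ι b) s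
  GArc-local z a b pos (w , wa , e₁ , e₂) =
    patch z w , trans (lookup-patch-ι z w a) wa ,
    trans (sym (lookup-local z w b)) e₁ , trans (sym (lookup-local-flip z w a b)) e₂
  GArc-local z a b neg (w , wa , e₁ , e₂) =
    patch z w , trans (lookup-patch-ι z w a) wa ,
    trans (sym (lookup-local z w b)) e₁ , trans (sym (lookup-local-flip z w a b)) e₂

  𝓕 : BN size → Set
  𝓕 g = ∃ λ z → A z × local z ≡ g

  𝓕-nonempty : ∃ 𝓕
  𝓕-nonempty = let (z , Az) = proj₁ attA in local z , z , Az , refl

  𝓕-spanning : ∀ g → 𝓕 g → SpanningSub g (Induced G ι)
  𝓕-spanning _ (z , _ , refl) a b s arc = proj₁ (f∈F (ι a) (ι b) s) (GArc-local z a b s arc)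

  Γ-restrict : ∀ {x z} → AgreeOn P x z → A z → ∀ a → lookup (f x) (ι a) ≢ lookup x (ι a) →
               Γ⋃ 𝓕 (restrict x) (restrict (flip x (ι a)))
  Γ-restrict {x} {z} x≈z Az a fx≢x =
    local z , (z , Az , refl) , a , local≢x , restrict-flip-ι x a
    where
    local≢x : lookup (local z (restrict x)) a ≢ lookup (restrict x) a
    local≢x eq = fx≢x (trans (f-agrees-local x≈z a) (trans eq (lookup-restrict x a)))

  projection : CSet n → CSet size
  projection X w = ∃ λ x → X x × restrict x ≡ w

  module _ {X : CSet n} (attX : Attractor (Γ f) X) (A⊆X : A ⊆[ P ] X) (X⊆A : X ⊆[ P ] A) where

    private
      X-trap : Trap (Γ f) X
      X-trap = proj₁ (proj₂ attX)

    -- Inside X, x can be moved to agree with z on P without changing its C-coordinates;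
    -- there f acts on C exactly as local z.
    projection-trap : Trap (Γ⋃ 𝓕) (projection X)
    projection-trap _ _ (x , Xx , refl) (_ , (z , Az , refl) , a , local≢x , refl)
      with A⊆X z Az
    ... | x₁ , Xx₁ , z≈x₁ with Attractor-recombine P-closed attX Xx Xx₁
    ... | y , Xy , y≈x₁ , y≈x =
      flip y (ι a) , X-trap y _ Xy (ι a , fy≢y , refl) ,
      trans (restrict-flip-ι y a) (cong (λ w → flip w a) y↾≡x↾)
      where
      y↾≡x↾ : restrict y ≡ restrict x
      y↾≡x↾ = AgreeOn⇒restrict-≡ {y} {x} λ i i∈C → y≈x i (C∩P=∅ i∈C)

      y≈z : AgreeOn P y z
      y≈z i i∈P = trans (y≈x₁ i i∈P) (sym (z≈x₁ i i∈P))

      fy≢y : lookup (f y) (ι a) ≢ lookup y (ι a)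
      fy≢y eq = local≢x (begin
        lookup (local z (restrict x)) a ≡⟨ cong (λ w → lookup (local z w) a) y↾≡x↾ ⟨
        lookup (local z (restrict y)) a ≡⟨ f-agrees-local y≈z a ⟨
        lookup (f y) (ι a)              ≡⟨ eq ⟩
        lookup y (ι a)                  ≡⟨ lookup-restrict y a ⟨
        lookup (restrict y) a           ≡⟨ cong (λ w → lookup w a) y↾≡x↾ ⟩
        lookup (restrict x) a           ∎)
        where open ≡-Reasoning

    projection-minimal : ∀ W → NonEmpty W → Trap (Γ⋃ 𝓕) W → W ⊆c projection X → projection X ⊆c W
    projection-minimal W (w , Ww) W-trap W⊆X↾ _ (x , Xx , refl) = proj₂ (X⊆T x Xx)
      where
      T : CSet n
      T x = X x × W (restrict x)

      T-nonempty : NonEmpty T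
      T-nonempty = let (x , Xx , x↾≡w) = W⊆X↾ w Ww in x , Xx , subst W (sym x↾≡w) Ww

      T-trap : Trap (Γ f) T
      T-trap x _ (Xx , Wx↾) (i , fx≢x , refl) = X-trap x _ Xx (i , fx≢x , refl) , W-flip (i ∈? C)
        where
        W-flip : Dec (i ∈ C) → W (restrict (flip x i))
        W-flip (no i∉C)  = subst W (sym (restrict-flip-∉ x i∉C)) Wx↾
        W-flip (yes i∈C) =
          let (z , Az , x≈z) = X⊆A x Xx
              fx≢x′ = subst (λ j → lookup (f x) j ≢ lookup x j) (sym (ι-index i∈C)) fx≢x
          in subst (λ j → W (restrict (flip x j))) (ι-index i∈C)
                   (W-trap _ _ Wx↾ (Γ-restrict x≈z Az (index i∈C) fx≢x′))

      X⊆T : X ⊆c T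
      X⊆T = proj₂ (proj₂ attX) T T-nonempty T-trap (λ _ → proj₁)

    projection-attractor : Attractor (Γ⋃ 𝓕) (projection X)
    projection-attractor =
      (let (x , Xx) = proj₁ attX in restrict x , x , Xx , refl) , projection-trap , projection-minimal

  projection-span : ∀ {X x} → Span X x → Span (projection X) (restrict x)
  projection-span {X} {x} x∈[X] I c X↾⊆I,c a a∈I = begin
    lookup (restrict x) a   ≡⟨ lookup-restrict x a ⟩
    lookup x (ι a)          ≡⟨ x∈[X] (lift I) (patch x c) X⊆lift (ι a) (ι∈lift a∈I) ⟩
    lookup (patch x c) (ι a) ≡⟨ lookup-patch-ι x c a ⟩
    lookup c a              ∎
    where
    open ≡-Reasoning
    X⊆lift : X ⊆c Subspace (lift I) (patch x c)
    X⊆lift y Xy i i∈lift =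
      let (i∈C , index∈I) = ∈lift⇒index∈ i∈lift
      in begin
        lookup y i                    ≡⟨ cong (lookup y) (ι-index i∈C) ⟨
        lookup y (ι (index i∈C))      ≡⟨ lookup-restrict y (index i∈C) ⟨
        lookup (restrict y) (index i∈C) ≡⟨ X↾⊆I,c (restrict y) (y , Xy , refl) (index i∈C) index∈I ⟩
        lookup c (index i∈C)          ≡⟨ lookup-patch-∈ x c i∈C ⟨
        lookup (patch x c) i          ∎

  projection-⊆⇒⊆[∪] : ∀ {X Y} → Attractor (Γ f) Y → X ⊆[ P ] Y → projection X ⊆c projection Y → X ⊆[ P ∪ C ] Y
  projection-⊆⇒⊆[∪] attY X⊆Y X↾⊆Y↾ x Xx
    with X↾⊆Y↾ (restrict x) (x , Xx , refl) | X⊆Y x Xx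
  ... | y₀ , Yy₀ , y₀↾≡x↾ | y₁ , Yy₁ , x≈y₁ with Attractor-recombine P-closed attY Yy₀ Yy₁
  ... | y , Yy , y≈y₁ , y≈y₀ =
    y , Yy , AgreeOn-∪ {x = x} {y} (λ i i∈P → trans (x≈y₁ i i∈P) (sym (y≈y₁ i i∈P)))
                       (λ i i∈C → trans (restrict-≡⇒AgreeOn {x} {y₀} (sym y₀↾≡x↾) i i∈C) (sym (y≈y₀ i (C∩P=∅ i∈C))))

  ¬¬-agreement-extends : RobustlySeparating (Induced G ι) →
    ∀ {B} → Attractor (Γ f) B → ∀ x₀ → Span A x₀ → Span B x₀ →
    A ⊆[ P ] B → B ⊆[ P ] A → DoubleNegation (A ⊆[ P ∪ C ] B × B ⊆[ P ∪ C ] A)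
  ¬¬-agreement-extends robust {B} attB x₀ x₀∈[A] x₀∈[B] A⊆B B⊆A = do
    yes (A↾⊆B↾ , B↾⊆A↾) ←
      ¬¬-excluded-middle {A = projection A ⊆c projection B × projection B ⊆c projection A}
      where no A↾≠B↾ → λ _ → robust 𝓕 𝓕-nonempty 𝓕-spanning (projection A) (projection B)
                               (projection-attractor attA (⊆[]-refl P) (⊆[]-refl P))
                               (projection-attractor attB A⊆B B⊆A)
                               A↾≠B↾ (restrict x₀)
                               (projection-span {x = x₀} x₀∈[A] , projection-span {x = x₀} x₀∈[B])
    pure (projection-⊆⇒⊆[∪] attB A⊆B A↾⊆B↾ , projection-⊆⇒⊆[∪] attA B⊆A B↾⊆A↾)

ComponentsRobustlySeparating : SDigraph n → Set₁
ComponentsRobustlySeparating {n} G =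
  ∀ (I : Subset n) → StrongComponent G I →
  ∀ (k : ℕ) (ι : Fin k → Fin n) →
  (∀ a b → ι a ≡ ι b → a ≡ b) →
  (∀ v → (v ∈ I → ∃ λ a → ι a ≡ v) × ((∃ λ a → ι a ≡ v) → v ∈ I)) →
  RobustlySeparating (Induced G ι)

module _ {G : SDigraph n} (robust : ComponentsRobustlySeparating G)
         {f : BN n} (f∈F : InF G f)
         {A B : CSet n} (attA : Attractor (Γ f) A) (attB : Attractor (Γ f) B)
         (x₀ : Config n) (x₀∈[A] : Span A x₀) (x₀∈[B] : Span B x₀) where

  open Components G

  ¬¬-agree : ∀ P → PredecessorClosed G P → Acc _⊂_ P → DoubleNegation (A ⊆[ P ] B × B ⊆[ P ] A)
  ¬¬-agree P P-closed (acc smaller) with nonempty? P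
  ... | no P=∅ = pure (vacuous attB , vacuous attA)
    where
    vacuous : ∀ {X Y} → Attractor (Γ f) Y → X ⊆[ P ] Y
    vacuous ((y , Yy) , _) _ _ = y , Yy , λ i i∈P → contradiction (i , i∈P) P=∅
  ... | yes (v , v∈P) = do
    (u , u∈P , sink) ← ¬¬-sink v∈P
    (C , C⇔) ← ¬¬-subset (λ i → Reach u i × Reach i u)
    let open Peel P-closed u∈P sink C⇔
        open Enumeration (enumerate C)
    (A⊆B , B⊆A) ← ¬¬-agree rest rest-closed (smaller rest⊂P)
    (A⊆B′ , B⊆A′) ← Separation.¬¬-agreement-extends f∈F attA rest-closed C∩rest=∅ inputs-of-C (enumerate C)
                      (robust C C-component size ι injective range) attB x₀ x₀∈[A] x₀∈[B] A⊆B B⊆A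
    pure (⊆[]-antimono P⊆rest∪C A⊆B′ , ⊆[]-antimono P⊆rest∪C B⊆A′)

lemma20 : ∀ (n : ℕ) (G : SDigraph n) →
    (∀ (I : Subset n) → StrongComponent G I →
      ∀ (k : ℕ) (ι : Fin k → Fin n) →
      (∀ a b → ι a ≡ ι b → a ≡ b) →
      (∀ v → (v ∈ I → ∃ λ a → ι a ≡ v) × ((∃ λ a → ι a ≡ v) → v ∈ I)) →
      RobustlySeparating (Induced G ι)) →
    Separating G
lemma20 n G robust f f∈F A B attA attB A≠B x₀ (x₀∈[A] , x₀∈[B]) =
  ¬¬-agree robust f∈F attA attB x₀ x₀∈[A] x₀∈[B] ⊤ (λ _ _ _ _ → ∈⊤) (⊂-wellFounded ⊤)
    λ (A⊆B , B⊆A) → A≠B (⊆[⊤]⇒⊆c A⊆B , ⊆[⊤]⇒⊆c B⊆A)
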